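{- Let $\alpha>1$ be irrational and let $x$ be a positive integer. If $E(x)>0$, then $x\in S_\alpha$ if and only if there is no positive integer $y<x$ with $y\ne x/2$ such that either $0<E(y)<E(x)$ or $0<E(y)+\alpha/2<E(x)$. If $E(x)<0$, then $x\in S_\alpha$ if and only if there is no positive integer $y<x$ with $y\ne x/2$ such that either $0>E(y)>E(x)$ or $0>E(y)-\alpha/2>E(x)$.
   Context: For a positive integer $n$, $E(n)=n-q\alpha$, where $q\alpha$ is the integer multiple of $\alpha$ nearest to $n$ (so $|E(n)|<\alpha/2$ and $E(n)\neq0$). Let $A_\alpha=\{n\in\mathbb N: E(n)<0\}$ (the nearest multiple of $\alpha$ exceeds $n$) and $B_\alpha=\{n\in\mathbb N: E(n)>0\}$. $S_\alpha$ is the set of positive integers that cannot be written as $y_1+y_2$ with $y_1\ne y_2$ both in $A_\alpha$ or both in $B_\alpha$ (the set avoided by the partition $\{A_\alpha,B_\alpha\}$). -}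

module Defs where

open import Level using (0ℓ)
open import Data.Nat as ℕ using (ℕ)
open import Data.Integer as ℤ using (ℤ; +_)
open import Data.Rational using (ℚ; _<_; _+_; _-_; _*_; -_; 0ℚ; 1ℚ; ½; _/_)
open import Data.Product using (Σ; ∃; _×_; _,_)
open import Data.Sum using (_⊎_)
open import Data.Empty using (⊥)
open import Relation.Nullary using (¬_)
open import Relation.Binary.PropositionalEquality using (_≡_; _≢_)

-- A real number as a (two-sided, constructive) Dedekind cut of ℚ:
-- L q  means  q < α ,  U q  means  α < q .
record Real : Set₁ where
  field
    L U        : ℚ → Set
    L-inhabited : ∃ λ q → L q
    U-inhabited : ∃ λ q → U q
    L-lower    : ∀ {p q} → p < q → L q → L p
    L-round    : ∀ {q} → L q → ∃ λ r → q < r × L r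
    U-upper    : ∀ {p q} → p < q → U p → U q
    U-round    : ∀ {q} → U q → ∃ λ r → r < q × U r
    disjoint   : ∀ {q} → L q → U q → ⊥
    located    : ∀ {p q} → p < q → L p ⊎ U q
open Real public

Irrational : Real → Set
Irrational α = ∀ q → L α q ⊎ U α q

OneLt : Real → Set
OneLt α = L α 1ℚ

record Lin : Set where
  constructor _+_·α
  field
    coef₀ coef₁ : ℚ
open Lin public

_⊕_ : Lin → Lin → Lin
(a + b ·α) ⊕ (c + d ·α) = (a + c) + (b + d) ·α

⊖_ : Lin → Lin
⊖ (a + b ·α) = (- a) + (- b) ·α

_⊝_ : Lin → Lin → Lin
u ⊝ v = u ⊕ (⊖ v)

halfα : Lin
halfα = 0ℚ + ½ ·α

-- The real number  a + b·α  is positive (> 0), using the Dedekind order: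
-- witnessed by a rational r on the correct side of α.
Pos : Real → Lin → Set
Pos α (a + b ·α) =
  ∃ λ r → (0ℚ < a + b * r) × (0ℚ < b → L α r) × (b < 0ℚ → U α r)

ℕ→ℚ : ℕ → ℚ
ℕ→ℚ n = + n / 1

ℤ→ℚ : ℤ → ℚ
ℤ→ℚ z = z / 1

Eform : ℕ → ℤ → Lin
Eform n q = ℕ→ℚ n + (- ℤ→ℚ q) ·α

-- q·α is the integer multiple of α nearest to n:  −α/2 < n − qα < α/2
Nearest : Real → ℕ → ℤ → Set
Nearest α n q = Pos α (Eform n q ⊕ halfα) × Pos α (halfα ⊝ Eform n q)

InA : Real → ℕ → Set
InA α n = ℕ.NonZero n × ∃ λ q → Nearest α n q × Pos α (⊖ Eform n q)

InB : Real → ℕ → Set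
InB α n = ℕ.NonZero n × ∃ λ q → Nearest α n q × Pos α (Eform n q)

InS : Real → ℕ → Set
InS α x = ℕ.NonZero x ×
  ¬ (∃ λ y₁ → ∃ λ y₂ → y₁ ≢ y₂ × y₁ ℕ.+ y₂ ≡ x ×
       ((InA α y₁ × InA α y₂) ⊎ (InB α y₁ × InB α y₂)))

CondB : Real → ℕ → ℤ → Set
CondB α x qx = ∃ λ y → ∃ λ qy →
  ℕ.NonZero y × y ℕ.< x × 2 ℕ.* y ≢ x × Nearest α y qy ×
  ((Pos α (Eform y qy) × Pos α (Eform x qx ⊝ Eform y qy))
   ⊎ (Pos α (Eform y qy ⊕ halfα) × Pos α (Eform x qx ⊝ (Eform y qy ⊕ halfα))))

CondA : Real → ℕ → ℤ → Set
CondA α x qx = ∃ λ y → ∃ λ qy →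
  ℕ.NonZero y × y ℕ.< x × 2 ℕ.* y ≢ x × Nearest α y qy ×
  ((Pos α (⊖ Eform y qy) × Pos α (Eform y qy ⊝ Eform x qx))
   ⊎ (Pos α (⊖ (Eform y qy ⊝ halfα)) × Pos α ((Eform y qy ⊝ halfα) ⊝ Eform x qx)))

{-# OPTIONS --safe #-}

-- E-values are linear forms a + b·α with rational coefficients, and a form is positive when
-- it is positive on a rational neighbourhood of α. Positivity is closed under addition, so
-- every inequality of the argument is a sum of hypotheses up to an identity of linear forms.
-- If y + z = x then E(x) − E(y) − E(z) = kα for an integer k. As E-values lie in (−α/2, α/2)
-- and two E-values of x less than α apart have the same multiplier, k is forced: k = 0 when
-- y, z and x lie in the same class, and k = ±1 when y and z lie in the class opposite to x.
-- Hence x = y + z with y ≠ z in a common class exactly when y < x, y ≠ x/2 and E(y) lies in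
-- the window of the statement, taking z = x − y.
module Submission where

open import Defs
open import Data.Nat using (ℕ; NonZero)
open import Data.Integer using (ℤ)
open import Data.Product using (_×_)
open import Function.Bundles using (_⇔_)
open import Relation.Nullary using (¬_)

open import Level using (0ℓ)
open import Algebra.Bundles using (RawRing; CommutativeRing)
import Algebra.Construct.DirectProduct as DirectProduct
open import Algebra.Morphism.Structures using (IsRingMonomorphism)
import Algebra.Morphism.RingMonomorphism as RingMonomorphism
open import Data.Empty using (⊥-elim)
open import Data.List using (_∷_; [])
open import Data.Maybe using (Maybe; zipWith)
import Data.Nat as ℕ
import Data.Nat.Properties as ℕ
import Data.Nat.Coprimality as Coprime
import Data.Integer as ℤ
import Data.Integer.Properties as ℤ
import Data.Integer.Tactic.RingSolver as ℤ-Solver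
open import Data.Product using (∃; _,_; proj₁; proj₂)
open import Data.Rational as ℚ using (ℚ; mkℚ; _<_; _≤_; _+_; _*_; -_; 0ℚ; 1ℚ; ½; _/_; _⊔_; _⊓_)
import Data.Rational.Properties as ℚ
open import Data.Sum using (_⊎_; inj₁; inj₂)
open import Function.Base using (_∘_; const)
open import Function.Bundles using (mk⇔)
open import Relation.Binary.Definitions using (tri<; tri≈; tri>)
open import Relation.Binary.PropositionalEquality
open import Relation.Nullary using (Dec; yes; no)
open import Relation.Nullary.Decidable using (dec⇒maybe)
open import Tactic.RingSolver using (solve-∀; solve)
open import Tactic.RingSolver.Core.AlmostCommutativeRing
  using (AlmostCommutativeRing; fromCommutativeRing)

complement : ∀ {x y} → y ℕ.< x → 2 ℕ.* y ≢ x → ∃ λ z → NonZero z × y ≢ z × y ℕ.+ z ≡ x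
complement {x} {y} y<x 2y≢x =
  x ℕ.∸ y , ℕ.>-nonZero (ℕ.m<n⇒0<n∸m y<x) , y≢x∸y , y+[x∸y]≡x
  where
  y+[x∸y]≡x : y ℕ.+ (x ℕ.∸ y) ≡ x
  y+[x∸y]≡x = ℕ.m+[n∸m]≡n (ℕ.<⇒≤ y<x)
  y≢x∸y : y ≢ x ℕ.∸ y
  y≢x∸y y≡x∸y =
    2y≢x (trans (cong (y ℕ.+_) (ℕ.+-identityʳ y)) (trans (cong (y ℕ.+_) y≡x∸y) y+[x∸y]≡x))

summand-< : ∀ {y₁ y₂ x} → NonZero y₂ → y₁ ℕ.+ y₂ ≡ x → y₁ ℕ.< x
summand-< {y₁} {y₂} y₂≢0 refl = ℕ.m<m+n y₁ (ℕ.>-nonZero⁻¹ y₂ {{y₂≢0}})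

summand-≢-half : ∀ {y₁ y₂ x} → y₁ ≢ y₂ → y₁ ℕ.+ y₂ ≡ x → 2 ℕ.* y₁ ≢ x
summand-≢-half {y₁} y₁≢y₂ refl 2y₁≡x =
  y₁≢y₂ (ℕ.+-cancelˡ-≡ y₁ _ _ (trans (cong (y₁ ℕ.+_) (sym (ℕ.+-identityʳ y₁))) 2y₁≡x))

ℚ-ring : AlmostCommutativeRing 0ℓ 0ℓ
ℚ-ring = fromCommutativeRing ℚ.+-*-commutativeRing (dec⇒maybe ∘ (0ℚ ℚ.≟_))

ℤ→ℚ-+ : ∀ i j → ℤ→ℚ (i ℤ.+ j) ≡ ℤ→ℚ i + ℤ→ℚ j
ℤ→ℚ-+ i j = begin
  (i ℤ.+ j) / 1                     ≡⟨ cong₂ (λ a b → (a ℤ.+ b) / 1) (ℤ.*-identityʳ i) (ℤ.*-identityʳ j) ⟨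
  (i ℤ.* ℤ.+ 1 ℤ.+ j ℤ.* ℤ.+ 1) / 1 ≡⟨⟩
  ⟦ i ⟧ + ⟦ j ⟧                     ≡⟨ cong₂ _+_ (ℚ.↥p/↧p≡p ⟦ i ⟧) (ℚ.↥p/↧p≡p ⟦ j ⟧) ⟨
  i / 1 + j / 1                     ∎
  where
  open ≡-Reasoning
  ⟦_⟧ : ℤ → ℚ
  ⟦ k ⟧ = mkℚ k 0 (Coprime.sym (Coprime.1-coprimeTo _))

1≤ℤ→ℚ-suc : ∀ n → 1ℚ ≤ ℤ→ℚ ℤ.+[1+ n ]
1≤ℤ→ℚ-suc n = subst (1ℚ ≤_) (sym (ℤ→ℚ-+ (ℤ.+ 1) (ℤ.+ n)))
  (ℚ.+-monoʳ-≤ 1ℚ (ℚ.nonNegative⁻¹ (ℤ→ℚ (ℤ.+ n)) {{ℚ.normalize-nonNeg n 1}}))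

ℤ→ℚ-within-1⇒0 : ∀ k → 0ℚ < - ℤ→ℚ k + 1ℚ → 0ℚ < 1ℚ + - - ℤ→ℚ k → k ≡ ℤ.0ℤ
ℤ→ℚ-within-1⇒0 (ℤ.+ 0)    _     _     = refl
ℤ→ℚ-within-1⇒0 ℤ.+[1+ n ] 0<1-k _     = ⊥-elim (ℚ.<-irrefl refl (ℚ.<-≤-trans 0<1-k 1-k≤0))
  where
  1-k≤0 : - ℤ→ℚ ℤ.+[1+ n ] + 1ℚ ≤ 0ℚ
  1-k≤0 = ℚ.+-monoˡ-≤ 1ℚ (ℚ.neg-antimono-≤ (1≤ℤ→ℚ-suc n))
ℤ→ℚ-within-1⇒0 ℤ.-[1+ n ] _     0<1+k = ⊥-elim (ℚ.<-irrefl refl (ℚ.<-≤-trans 0<1+k 1+k≤0))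
  where
  neg-involutive : ∀ p → - p ≡ - - - p
  neg-involutive = solve-∀ ℚ-ring
  -- ℤ→ℚ -[1+ n ] is - ℤ→ℚ +[1+ n ] by the definition of _/_.
  1+k≤0 : 1ℚ + - - ℤ→ℚ ℤ.-[1+ n ] ≤ 0ℚ
  1+k≤0 = subst (λ t → 1ℚ + t ≤ 0ℚ) (neg-involutive (ℤ→ℚ ℤ.+[1+ n ]))
    (ℚ.+-monoʳ-≤ 1ℚ (ℚ.neg-antimono-≤ (1≤ℤ→ℚ-suc n)))

-- The pointwise product makes Lin a commutative ring (a copy of ℚ × ℚ).
_⊛_ : Lin → Lin → Lin
(a + b ·α) ⊛ (c + d ·α) = (a * c) + (b * d) ·α

0ₗ 1ₗ 1·α : Lin
0ₗ  = 0ℚ + 0ℚ ·α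
1ₗ  = 1ℚ + 1ℚ ·α
1·α = 0ℚ + 1ℚ ·α

coefficients : Lin → ℚ × ℚ
coefficients (a + b ·α) = a , b

Lin-rawRing : RawRing 0ℓ 0ℓ
Lin-rawRing = record { _≈_ = _≡_ ; _+_ = _⊕_ ; _*_ = _⊛_ ; -_ = ⊖_ ; 0# = 0ₗ ; 1# = 1ₗ }

ℚ×ℚ : CommutativeRing 0ℓ 0ℓ
ℚ×ℚ = DirectProduct.commutativeRing ℚ.+-*-commutativeRing ℚ.+-*-commutativeRing

coefficients-isRingMonomorphism :
  IsRingMonomorphism Lin-rawRing (CommutativeRing.rawRing ℚ×ℚ) coefficients
coefficients-isRingMonomorphism = record
  { isRingHomomorphism = record
    { isSemiringHomomorphism = record
      { isNearSemiringHomomorphism = record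
        { +-isMonoidHomomorphism = record
          { isMagmaHomomorphism = record
            { isRelHomomorphism = record { cong = λ { refl → refl , refl } }
            ; homo = λ _ _ → refl , refl
            }
          ; ε-homo = refl , refl
          }
        ; *-homo = λ _ _ → refl , refl
        }
      ; 1#-homo = refl , refl
      }
    ; -‿homo = λ _ → refl , refl
    }
  ; injective = λ { (refl , refl) → refl }
  }

Lin-commutativeRing : CommutativeRing 0ℓ 0ℓ
Lin-commutativeRing = record
  { isCommutativeRing = RingMonomorphism.isCommutativeRing coefficients-isRingMonomorphism
      (CommutativeRing.isCommutativeRing ℚ×ℚ)
  }

Lin-ring : AlmostCommutativeRing 0ℓ 0ℓ
Lin-ring = fromCommutativeRing Lin-commutativeRing 0ₗ≟_
  where
  0ₗ≟_ : ∀ u → Maybe (0ₗ ≡ u)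
  0ₗ≟ (a + b ·α) = zipWith (cong₂ _+_·α) (dec⇒maybe (0ℚ ℚ.≟ a)) (dec⇒maybe (0ℚ ℚ.≟ b))

Eform-+ : ∀ m n p q → Eform (m ℕ.+ n) (p ℤ.+ q) ≡ Eform m p ⊕ Eform n q
Eform-+ m n p q = cong₂ _+_·α (ℤ→ℚ-+ (ℤ.+ m) (ℤ.+ n))
  (trans (cong -_ (ℤ→ℚ-+ p q)) (ℚ.neg-distrib-+ (ℤ→ℚ p) (ℤ→ℚ q)))

Eform-shift : ∀ n q k → Eform n (q ℤ.+ k) ≡ Eform n q ⊕ Eform 0 k
Eform-shift n q k = trans (cong (λ m → Eform m (q ℤ.+ k)) (sym (ℕ.+-identityʳ n))) (Eform-+ n 0 q k)

Eform-sum : ∀ y₁ y₂ {x} → y₁ ℕ.+ y₂ ≡ x → ∀ q₁ q₂ k →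
            Eform x (q₁ ℤ.+ q₂ ℤ.+ k) ≡ (Eform y₁ q₁ ⊕ Eform y₂ q₂) ⊕ Eform 0 k
Eform-sum y₁ y₂ refl q₁ q₂ k =
  trans (Eform-shift (y₁ ℕ.+ y₂) (q₁ ℤ.+ q₂) k) (cong (_⊕ Eform 0 k) (Eform-+ y₁ y₂ q₁ q₂))

Eform-complement : ∀ y z {x} → y ℕ.+ z ≡ x → ∀ qx qy k →
                   Eform x qx ≡ (Eform y qy ⊕ Eform z (qx ℤ.- qy ℤ.- k)) ⊕ Eform 0 k
Eform-complement y z {x} y+z≡x qx qy k =
  trans (cong (Eform x) (sym (multipliers qx qy k))) (Eform-sum y z y+z≡x qy (qx ℤ.- qy ℤ.- k) k)
  where
  multipliers : ∀ qx qy k → qy ℤ.+ (qx ℤ.- qy ℤ.- k) ℤ.+ k ≡ qx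
  multipliers = ℤ-Solver.solve-∀

eval : Lin → ℚ → ℚ
eval u r = coef₀ u + coef₁ u * r

eval-⊕ : ∀ u v r → eval (u ⊕ v) r ≡ eval u r + eval v r
eval-⊕ (a + b ·α) (c + d ·α) r = distrib a b c d r
  where
  distrib : ∀ a b c d r → (a + c) + (b + d) * r ≡ (a + b * r) + (c + d * r)
  distrib = solve-∀ ℚ-ring

module Positivity (α : Real) (0<α : L α 0ℚ) where

  L<U : ∀ {p q} → L α p → U α q → p < q
  L<U {p} {q} p∈L q∈U with ℚ.<-cmp p q
  ... | tri< p<q _ _ = p<q
  ... | tri≈ _ refl _ = ⊥-elim (disjoint α p∈L q∈U)
  ... | tri> _ _ q<p = ⊥-elim (disjoint α (L-lower α q<p p∈L) q∈U)

  -- Pos α u computes by pattern matching on u, so the type checker cannot recover u from it;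
  -- this record determines u, and brackets [lower, upper] around α can be intersected.
  record Positive (u : Lin) : Set where
    field
      lower upper : ℚ
      lower∈L     : L α lower
      upper∈U     : U α upper
      positive-on : ∀ {r} → lower ≤ r → r ≤ upper → 0ℚ < eval u r

    lower≤upper : lower ≤ upper
    lower≤upper = ℚ.<⇒≤ (L<U lower∈L upper∈U)

  fromPos : ∀ {u} → Pos α u → Positive u
  fromPos {a + b ·α} (r , 0<u[r] , L-if-b>0 , U-if-b<0) with ℚ.<-cmp 0ℚ b
  ... | tri< 0<b _ _ = record
    { lower = r ; upper = proj₁ (U-inhabited α)
    ; lower∈L = L-if-b>0 0<b ; upper∈U = proj₂ (U-inhabited α)
    ; positive-on = λ r≤s _ → ℚ.<-≤-trans 0<u[r]
        (ℚ.+-monoʳ-≤ a (ℚ.*-monoˡ-≤-nonNeg b {{ℚ.nonNegative (ℚ.<⇒≤ 0<b)}} r≤s))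
    }
  ... | tri≈ _ refl _ = record
    { lower = proj₁ (L-inhabited α) ; upper = proj₁ (U-inhabited α)
    ; lower∈L = proj₂ (L-inhabited α) ; upper∈U = proj₂ (U-inhabited α)
    ; positive-on = λ {s} _ _ →
        subst (λ t → 0ℚ < a + t) (trans (ℚ.*-zeroˡ r) (sym (ℚ.*-zeroˡ s))) 0<u[r]
    }
  ... | tri> _ _ b<0 = record
    { lower = proj₁ (L-inhabited α) ; upper = r
    ; lower∈L = proj₂ (L-inhabited α) ; upper∈U = U-if-b<0 b<0
    ; positive-on = λ _ s≤r → ℚ.<-≤-trans 0<u[r]
        (ℚ.+-monoʳ-≤ a (ℚ.*-monoˡ-≤-nonPos b {{ℚ.nonPositive (ℚ.<⇒≤ b<0)}} s≤r))
    }

  toPos : ∀ {u} → Positive u → Pos α u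
  toPos {a + b ·α} p = at-endpoint (0ℚ ℚ.<? b)
    where
    open Positive p
    at-endpoint : Dec (0ℚ < b) → Pos α (a + b ·α)
    at-endpoint (yes 0<b) = lower , positive-on ℚ.≤-refl lower≤upper , const lower∈L ,
                            λ b<0 → ⊥-elim (ℚ.<-asym 0<b b<0)
    at-endpoint (no 0≮b)  = upper , positive-on lower≤upper ℚ.≤-refl ,
                            (λ 0<b → ⊥-elim (0≮b 0<b)) , const upper∈U

  infixl 6 _⊕⁺_
  _⊕⁺_ : ∀ {u v} → Positive u → Positive v → Positive (u ⊕ v)
  _⊕⁺_ {u} {v} p q = record
    { lower = P.lower ⊔ Q.lower ; upper = P.upper ⊓ Q.upper
    ; lower∈L = either (L α) (ℚ.⊔-sel P.lower Q.lower) P.lower∈L Q.lower∈L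
    ; upper∈U = either (U α) (ℚ.⊓-sel P.upper Q.upper) P.upper∈U Q.upper∈U
    ; positive-on = λ {r} l≤r r≤h → subst (0ℚ <_) (sym (eval-⊕ u v r)) (ℚ.+-mono-<
        (P.positive-on (ℚ.≤-trans (ℚ.p≤p⊔q _ _) l≤r) (ℚ.≤-trans r≤h (ℚ.p⊓q≤p _ Q.upper)))
        (Q.positive-on (ℚ.≤-trans (ℚ.p≤q⊔p P.lower _) l≤r) (ℚ.≤-trans r≤h (ℚ.p⊓q≤q P.upper _))))
    }
    where
    module P = Positive p
    module Q = Positive q
    either : ∀ (A : ℚ → Set) {p q m} → m ≡ p ⊎ m ≡ q → A p → A q → A m
    either A (inj₁ refl) a _ = a
    either A (inj₂ refl) _ b = b

  infixl 0 _by_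
  _by_ : ∀ {u v} → Positive u → u ≡ v → Positive v
  p by refl = p

  halfα-positive : Positive halfα
  halfα-positive =
    let (r , 0<r , r∈L) = L-round α 0<α
    in fromPos ( r , subst (0ℚ <_) (sym (ℚ.+-identityˡ (½ * r))) (ℚ.*-monoʳ-<-pos ½ 0<r)
               , const r∈L , λ ½<0 → ⊥-elim (ℚ.<-asym ½<0 (ℚ.positive⁻¹ ½)) )

  α-coefficient-positive : ∀ {c} → Positive (0ℚ + c ·α) → 0ℚ < c
  α-coefficient-positive {c} p with 0ℚ ℚ.<? c
  ... | yes 0<c = 0<c
  ... | no  0≮c = ⊥-elim (ℚ.<-irrefl refl (ℚ.<-≤-trans 0<c·upper c·upper≤0))
    where
    open Positive p
    0<c·upper : 0ℚ < c * upper
    0<c·upper = subst (0ℚ <_) (ℚ.+-identityˡ (c * upper)) (positive-on lower≤upper ℚ.≤-refl)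
    c·upper≤0 : c * upper ≤ 0ℚ
    c·upper≤0 = subst (c * upper ≤_) (ℚ.*-zeroˡ upper)
      (ℚ.*-monoʳ-≤-nonNeg upper {{ℚ.nonNegative (ℚ.<⇒≤ (L<U 0<α upper∈U))}} (ℚ.≮⇒≥ 0≮c))

Split : Real → ℕ → Set
Split α x = ∃ λ y₁ → ∃ λ y₂ → y₁ ≢ y₂ × y₁ ℕ.+ y₂ ≡ x ×
  ((InA α y₁ × InA α y₂) ⊎ (InB α y₁ × InB α y₂))

InS⇔¬ : ∀ α {x} {C : Set} → NonZero x → (C → Split α x) → (Split α x → C) → InS α x ⇔ (¬ C)
InS⇔¬ _ x≢0 C⇒split split⇒C = mk⇔ (λ (_ , ¬split) → ¬split ∘ C⇒split) (λ ¬C → x≢0 , ¬C ∘ split⇒C)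

module Splitting (α : Real) (0<α : L α 0ℚ) where
  open Positivity α 0<α

  ∣_−_∣<α : Lin → Lin → Set
  ∣ u − v ∣<α = Positive ((u ⊝ v) ⊕ 1·α) × Positive ((v ⊝ u) ⊕ 1·α)

  α-multiple-pinned : ∀ E k → ∣ E ⊕ Eform 0 k − E ∣<α → k ≡ ℤ.0ℤ
  α-multiple-pinned E k (above , below) = ℤ→ℚ-within-1⇒0 k
    (α-coefficient-positive (cancel-above (Eform 0 k) above))
    (α-coefficient-positive (cancel-below (Eform 0 k) below))
    where
    cancel-above : ∀ K → Positive (((E ⊕ K) ⊝ E) ⊕ 1·α) → Positive (K ⊕ 1·α)
    cancel-above K p = p by solve (E ∷ K ∷ []) Lin-ring
    cancel-below : ∀ K → Positive ((E ⊝ (E ⊕ K)) ⊕ 1·α) → Positive (1·α ⊝ K)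
    cancel-below K p = p by solve (E ∷ K ∷ []) Lin-ring

  Eform-injective : ∀ n p q → ∣ Eform n p − Eform n q ∣<α → p ≡ q
  Eform-injective n p q close = ℤ.i-j≡0⇒i≡j p q
    (α-multiple-pinned (Eform n q) (p ℤ.- q) (subst (λ e → ∣ e − Eform n q ∣<α) p-as-shift close))
    where
    q+[p-q]≡p : ∀ p q → q ℤ.+ (p ℤ.- q) ≡ p
    q+[p-q]≡p = ℤ-Solver.solve-∀
    p-as-shift : Eform n p ≡ Eform n q ⊕ Eform 0 (p ℤ.- q)
    p-as-shift = trans (cong (Eform n) (sym (q+[p-q]≡p p q))) (Eform-shift n q (p ℤ.- q))

  record Near (e : Lin) : Set where
    constructor near
    field
      lower-bound : Positive (e ⊕ halfα)
      upper-bound : Positive (halfα ⊝ e)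

  fromNearest : ∀ {e} → Pos α (e ⊕ halfα) × Pos α (halfα ⊝ e) → Near e
  fromNearest (p , q) = near (fromPos p) (fromPos q)

  toNearest : ∀ {e} → Near e → Pos α (e ⊕ halfα) × Pos α (halfα ⊝ e)
  toNearest (near p q) = toPos p , toPos q

  BValue AValue : Lin → Set
  BValue e = Near e × Positive e
  AValue e = Near e × Positive (⊖ e)

  difference-in-B : ∀ {X} Y Z → X ≡ (Y ⊕ Z) ⊕ 0ₗ →
                    Positive (halfα ⊝ X) → Positive Y → Positive (X ⊝ Y) → BValue Z
  difference-in-B Y Z refl X<h Y>0 Y<X =
    near (Z>0 ⊕⁺ halfα-positive) (X<h ⊕⁺ Y>0 by solve (Y ∷ Z ∷ []) Lin-ring) , Z>0
    where
    Z>0 : Positive Z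
    Z>0 = Y<X by solve (Y ∷ Z ∷ []) Lin-ring

  shifted-difference-in-A : ∀ {X} Y Z → X ≡ (Y ⊕ Z) ⊕ 1·α →
                            Positive (halfα ⊝ X) → Positive (Y ⊕ halfα) → Positive (X ⊝ (Y ⊕ halfα)) →
                            Positive (⊖ Y) × AValue Z
  shifted-difference-in-A Y Z refl X<h -h<Y Y+h<X =
    (Y+h<X ⊕⁺ X<h by solve (Y ∷ Z ∷ []) Lin-ring) ,
    near (Y+h<X by solve (Y ∷ Z ∷ []) Lin-ring)
         (-h<Y ⊕⁺ X<h ⊕⁺ halfα-positive by solve (Y ∷ Z ∷ []) Lin-ring) ,
    (-h<Y ⊕⁺ X<h by solve (Y ∷ Z ∷ []) Lin-ring)

  difference-in-A : ∀ {X} Y Z → X ≡ (Y ⊕ Z) ⊕ 0ₗ →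
                    Positive (X ⊕ halfα) → Positive (⊖ Y) → Positive (Y ⊝ X) → AValue Z
  difference-in-A Y Z refl -h<X Y<0 X<Y =
    near (-h<X ⊕⁺ Y<0 by solve (Y ∷ Z ∷ []) Lin-ring) (halfα-positive ⊕⁺ Z<0) , Z<0
    where
    Z<0 : Positive (⊖ Z)
    Z<0 = X<Y by solve (Y ∷ Z ∷ []) Lin-ring

  shifted-difference-in-B : ∀ {X} Y Z → X ≡ (Y ⊕ Z) ⊕ (⊖ 1·α) →
                            Positive (X ⊕ halfα) → Positive (halfα ⊝ Y) → Positive ((Y ⊝ halfα) ⊝ X) →
                            Positive Y × BValue Z
  shifted-difference-in-B Y Z refl -h<X Y<h X<Y-h =
    (X<Y-h ⊕⁺ -h<X by solve (Y ∷ Z ∷ []) Lin-ring) ,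
    near (Z>0 ⊕⁺ halfα-positive) (X<Y-h by solve (Y ∷ Z ∷ []) Lin-ring) , Z>0
    where
    Z>0 : Positive Z
    Z>0 = -h<X ⊕⁺ Y<h by solve (Y ∷ Z ∷ []) Lin-ring

  sum-of-Bs-in-B : ∀ X Y₁ Y₂ → let S = (Y₁ ⊕ Y₂) ⊕ 0ₗ in (∣ X − S ∣<α → X ≡ S) →
                   BValue X → BValue Y₁ → BValue Y₂ → Positive (X ⊝ Y₁)
  sum-of-Bs-in-B X Y₁ Y₂ pin (near _ X<h , X>0) (near _ Y₁<h , Y₁>0) (near _ Y₂<h , Y₂>0) =
    subst (λ X → Positive (X ⊝ Y₁))
      (sym (pin ( (X>0 ⊕⁺ Y₁<h ⊕⁺ Y₂<h by solve (X ∷ Y₁ ∷ Y₂ ∷ []) Lin-ring)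
                , (Y₁>0 ⊕⁺ Y₂>0 ⊕⁺ X<h ⊕⁺ halfα-positive by solve (X ∷ Y₁ ∷ Y₂ ∷ []) Lin-ring))))
      (Y₂>0 by solve (Y₁ ∷ Y₂ ∷ []) Lin-ring)

  sum-of-As-in-B : ∀ X Y₁ Y₂ → let S = (Y₁ ⊕ Y₂) ⊕ 1·α in (∣ X − S ∣<α → X ≡ S) →
                   BValue X → AValue Y₁ → AValue Y₂ → Positive (X ⊝ (Y₁ ⊕ halfα))
  sum-of-As-in-B X Y₁ Y₂ pin (near _ X<h , X>0) (near -h<Y₁ _ , Y₁<0) (near -h<Y₂ _ , Y₂<0) =
    subst (λ X → Positive (X ⊝ (Y₁ ⊕ halfα)))
      (sym (pin ( (X>0 ⊕⁺ Y₁<0 ⊕⁺ Y₂<0 by solve (X ∷ Y₁ ∷ Y₂ ∷ []) Lin-ring)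
                , (-h<Y₁ ⊕⁺ -h<Y₂ ⊕⁺ X<h ⊕⁺ halfα-positive by solve (X ∷ Y₁ ∷ Y₂ ∷ []) Lin-ring))))
      (-h<Y₂ by solve (Y₁ ∷ Y₂ ∷ []) Lin-ring)

  sum-of-As-in-A : ∀ X Y₁ Y₂ → let S = (Y₁ ⊕ Y₂) ⊕ 0ₗ in (∣ X − S ∣<α → X ≡ S) →
                   AValue X → AValue Y₁ → AValue Y₂ → Positive (Y₁ ⊝ X)
  sum-of-As-in-A X Y₁ Y₂ pin (near -h<X _ , X<0) (near -h<Y₁ _ , Y₁<0) (near -h<Y₂ _ , Y₂<0) =
    subst (λ X → Positive (Y₁ ⊝ X))
      (sym (pin ( (-h<X ⊕⁺ Y₁<0 ⊕⁺ Y₂<0 ⊕⁺ halfα-positive by solve (X ∷ Y₁ ∷ Y₂ ∷ []) Lin-ring)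
                , (-h<Y₁ ⊕⁺ -h<Y₂ ⊕⁺ X<0 by solve (X ∷ Y₁ ∷ Y₂ ∷ []) Lin-ring))))
      (Y₂<0 by solve (Y₁ ∷ Y₂ ∷ []) Lin-ring)

  sum-of-Bs-in-A : ∀ X Y₁ Y₂ → let S = (Y₁ ⊕ Y₂) ⊕ (⊖ 1·α) in (∣ X − S ∣<α → X ≡ S) →
                   AValue X → BValue Y₁ → BValue Y₂ →
                   Positive (⊖ (Y₁ ⊝ halfα)) × Positive ((Y₁ ⊝ halfα) ⊝ X)
  sum-of-Bs-in-A X Y₁ Y₂ pin (near -h<X _ , X<0) (near _ Y₁<h , Y₁>0) (near _ Y₂<h , Y₂>0) =
    (Y₁<h by solve (Y₁ ∷ []) Lin-ring) ,
    subst (λ X → Positive ((Y₁ ⊝ halfα) ⊝ X))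
      (sym (pin ( (-h<X ⊕⁺ Y₁<h ⊕⁺ Y₂<h ⊕⁺ halfα-positive by solve (X ∷ Y₁ ∷ Y₂ ∷ []) Lin-ring)
                , (Y₁>0 ⊕⁺ Y₂>0 ⊕⁺ X<0 by solve (X ∷ Y₁ ∷ Y₂ ∷ []) Lin-ring))))
      (Y₂<h by solve (Y₁ ∷ Y₂ ∷ []) Lin-ring)

  inB : ∀ {n} → NonZero n → ∀ q → BValue (Eform n q) → InB α n
  inB n≢0 q (e-near , e>0) = n≢0 , q , toNearest e-near , toPos e>0

  inA : ∀ {n} → NonZero n → ∀ q → AValue (Eform n q) → InA α n
  inA n≢0 q (e-near , e<0) = n≢0 , q , toNearest e-near , toPos e<0

  bValue : ∀ {e} → Pos α (e ⊕ halfα) × Pos α (halfα ⊝ e) → Pos α e → BValue e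
  bValue e-near e>0 = fromNearest e-near , fromPos e>0

  aValue : ∀ {e} → Pos α (e ⊕ halfα) × Pos α (halfα ⊝ e) → Pos α (⊖ e) → AValue e
  aValue e-near e<0 = fromNearest e-near , fromPos e<0

  Eform-sum-pinned : ∀ {x} qx y₁ y₂ → y₁ ℕ.+ y₂ ≡ x → ∀ q₁ q₂ k →
                     let S = (Eform y₁ q₁ ⊕ Eform y₂ q₂) ⊕ Eform 0 k in
                     ∣ Eform x qx − S ∣<α → Eform x qx ≡ S
  Eform-sum-pinned {x} qx y₁ y₂ y₁+y₂≡x q₁ q₂ k close = trans (cong (Eform x) qx≡) S≡
    where
    S≡ : Eform x (q₁ ℤ.+ q₂ ℤ.+ k) ≡ (Eform y₁ q₁ ⊕ Eform y₂ q₂) ⊕ Eform 0 k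
    S≡ = Eform-sum y₁ y₂ y₁+y₂≡x q₁ q₂ k
    qx≡ : qx ≡ q₁ ℤ.+ q₂ ℤ.+ k
    qx≡ = Eform-injective x qx _ (subst (λ S → ∣ Eform x qx − S ∣<α) (sym S≡) close)

  module _ (x : ℕ) (qx : ℤ) (x-near : Nearest α x qx) where

    CondB⇒Split : CondB α x qx → Split α x
    CondB⇒Split (y , qy , y≢0 , y<x , 2y≢x , y-near , inj₁ (Y>0 , Y<X)) =
      let (z , z≢0 , y≢z , y+z≡x) = complement y<x 2y≢x
          qz = qx ℤ.- qy ℤ.- ℤ.0ℤ
      in y , z , y≢z , y+z≡x , inj₂ ((y≢0 , qy , y-near , Y>0) , inB z≢0 qz
           (difference-in-B (Eform y qy) (Eform z qz) (Eform-complement y z y+z≡x qx qy ℤ.0ℤ)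
              (fromPos (proj₂ x-near)) (fromPos Y>0) (fromPos Y<X)))
    CondB⇒Split (y , qy , y≢0 , y<x , 2y≢x , y-near , inj₂ (-h<Y , Y+h<X)) =
      let (z , z≢0 , y≢z , y+z≡x) = complement y<x 2y≢x
          qz = qx ℤ.- qy ℤ.- ℤ.-1ℤ
          (Y<0 , Z-value) = shifted-difference-in-A (Eform y qy) (Eform z qz)
            (Eform-complement y z y+z≡x qx qy ℤ.-1ℤ)
            (fromPos (proj₂ x-near)) (fromPos -h<Y) (fromPos Y+h<X)
      in y , z , y≢z , y+z≡x , inj₁ ((y≢0 , qy , y-near , toPos Y<0) , inA z≢0 qz Z-value)

    CondA⇒Split : CondA α x qx → Split α x
    CondA⇒Split (y , qy , y≢0 , y<x , 2y≢x , y-near , inj₁ (Y<0 , X<Y)) =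
      let (z , z≢0 , y≢z , y+z≡x) = complement y<x 2y≢x
          qz = qx ℤ.- qy ℤ.- ℤ.0ℤ
      in y , z , y≢z , y+z≡x , inj₁ ((y≢0 , qy , y-near , Y<0) , inA z≢0 qz
           (difference-in-A (Eform y qy) (Eform z qz) (Eform-complement y z y+z≡x qx qy ℤ.0ℤ)
              (fromPos (proj₁ x-near)) (fromPos Y<0) (fromPos X<Y)))
    CondA⇒Split (y , qy , y≢0 , y<x , 2y≢x , y-near , inj₂ (_ , X<Y-h)) =
      let (z , z≢0 , y≢z , y+z≡x) = complement y<x 2y≢x
          qz = qx ℤ.- qy ℤ.- ℤ.1ℤ
          (Y>0 , Z-value) = shifted-difference-in-B (Eform y qy) (Eform z qz)
            (Eform-complement y z y+z≡x qx qy ℤ.1ℤ)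
            (fromPos (proj₁ x-near)) (fromPos (proj₂ y-near)) (fromPos X<Y-h)
      in y , z , y≢z , y+z≡x , inj₂ ((y≢0 , qy , y-near , toPos Y>0) , inB z≢0 qz Z-value)

    Split⇒CondB : Pos α (Eform x qx) → Split α x → CondB α x qx
    Split⇒CondB X>0 (y₁ , y₂ , y₁≢y₂ , y₁+y₂≡x ,
                     inj₂ ((y₁≢0 , q₁ , y₁-near , Y₁>0) , (y₂≢0 , q₂ , y₂-near , Y₂>0))) =
      y₁ , q₁ , y₁≢0 , summand-< y₂≢0 y₁+y₂≡x , summand-≢-half y₁≢y₂ y₁+y₂≡x , y₁-near ,
      inj₁ (Y₁>0 , toPos (sum-of-Bs-in-B (Eform x qx) (Eform y₁ q₁) (Eform y₂ q₂)
        (Eform-sum-pinned qx y₁ y₂ y₁+y₂≡x q₁ q₂ ℤ.0ℤ)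
        (bValue x-near X>0) (bValue y₁-near Y₁>0) (bValue y₂-near Y₂>0)))
    Split⇒CondB X>0 (y₁ , y₂ , y₁≢y₂ , y₁+y₂≡x ,
                     inj₁ ((y₁≢0 , q₁ , y₁-near , Y₁<0) , (y₂≢0 , q₂ , y₂-near , Y₂<0))) =
      y₁ , q₁ , y₁≢0 , summand-< y₂≢0 y₁+y₂≡x , summand-≢-half y₁≢y₂ y₁+y₂≡x , y₁-near ,
      inj₂ (proj₁ y₁-near , toPos (sum-of-As-in-B (Eform x qx) (Eform y₁ q₁) (Eform y₂ q₂)
        (Eform-sum-pinned qx y₁ y₂ y₁+y₂≡x q₁ q₂ ℤ.-1ℤ)
        (bValue x-near X>0) (aValue y₁-near Y₁<0) (aValue y₂-near Y₂<0)))

    Split⇒CondA : Pos α (⊖ Eform x qx) → Split α x → CondA α x qx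
    Split⇒CondA X<0 (y₁ , y₂ , y₁≢y₂ , y₁+y₂≡x ,
                     inj₁ ((y₁≢0 , q₁ , y₁-near , Y₁<0) , (y₂≢0 , q₂ , y₂-near , Y₂<0))) =
      y₁ , q₁ , y₁≢0 , summand-< y₂≢0 y₁+y₂≡x , summand-≢-half y₁≢y₂ y₁+y₂≡x , y₁-near ,
      inj₁ (Y₁<0 , toPos (sum-of-As-in-A (Eform x qx) (Eform y₁ q₁) (Eform y₂ q₂)
        (Eform-sum-pinned qx y₁ y₂ y₁+y₂≡x q₁ q₂ ℤ.0ℤ)
        (aValue x-near X<0) (aValue y₁-near Y₁<0) (aValue y₂-near Y₂<0)))
    Split⇒CondA X<0 (y₁ , y₂ , y₁≢y₂ , y₁+y₂≡x ,
                     inj₂ ((y₁≢0 , q₁ , y₁-near , Y₁>0) , (y₂≢0 , q₂ , y₂-near , Y₂>0))) =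
      let (Y₁-h<0 , X<Y₁-h) = sum-of-Bs-in-A (Eform x qx) (Eform y₁ q₁) (Eform y₂ q₂)
            (Eform-sum-pinned qx y₁ y₂ y₁+y₂≡x q₁ q₂ ℤ.1ℤ)
            (aValue x-near X<0) (bValue y₁-near Y₁>0) (bValue y₂-near Y₂>0)
      in y₁ , q₁ , y₁≢0 , summand-< y₂≢0 y₁+y₂≡x , summand-≢-half y₁≢y₂ y₁+y₂≡x , y₁-near ,
         inj₂ (toPos Y₁-h<0 , toPos X<Y₁-h)

mainTheorem2 : (α : Real) → Irrational α → OneLt α →
    (x : ℕ) → NonZero x → (qx : ℤ) → Nearest α x qx →
      (Pos α (Eform x qx) → (InS α x ⇔ (¬ CondB α x qx))) ×
      (Pos α (⊖ Eform x qx) → (InS α x ⇔ (¬ CondA α x qx)))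
mainTheorem2 α _ 1<α x x≢0 qx x-near =
    (λ X>0 → InS⇔¬ α x≢0 (CondB⇒Split x qx x-near) (Split⇒CondB x qx x-near X>0))
  , (λ X<0 → InS⇔¬ α x≢0 (CondA⇒Split x qx x-near) (Split⇒CondA x qx x-near X<0))
  where
  open Splitting α (L-lower α (ℚ.positive⁻¹ 1ℚ) 1<α)
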